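{- Let $R=R_1\times R_2\times\cdots\times R_t$, where each $R_i$ is a finite ring (associative, with nonzero identity), and for each $i$ let $\mathcal{M}_i$ be a maximal independent set of $\Gamma'(R_i)$. Then: (1) If for some $i$ we have $\mathcal{M}_i\subseteq R_i\setminus U(R_i)$, then $R_1\times\cdots\times R_{i-1}\times\mathcal{M}_i\times R_{i+1}\times\cdots\times R_t$ is a maximal independent set of $\Gamma'(R)$. (2) If $2\in U(R)$ and $\mathcal{M}_i\subseteq U(R_i)$ for each $i$, then $\mathcal{M}_1\times\mathcal{M}_2\times\cdots\times\mathcal{M}_t$ is a maximal independent set of $\Gamma'(R)$.
   Context: $U(S)$ is the set of units of a ring $S$. The unit graph $\Gamma'(S)$ has vertex set $S$, two distinct vertices $x,y$ adjacent iff $x+y\in U(S)$. -}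

module Defs where

open import Level using (Level; _⊔_)
open import Data.Nat using (ℕ)
open import Data.Fin using (Fin)
open import Data.Product using (Σ; Σ-syntax; _×_)
open import Relation.Nullary using (¬_)
open import Relation.Unary using (Pred; _∈_; _∪_)
open import Relation.Binary.PropositionalEquality using (setoid)
open import Function.Bundles using (Bijection)
open import Algebra.Bundles using (Ring)
open import Algebra.Bundles.Raw using (RawRing)

private
  variable
    c ℓ p : Level

Finite : Ring c ℓ → Set (c ⊔ ℓ)
Finite R = Σ[ n ∈ ℕ ] Bijection (setoid (Fin n)) (Ring.setoid R)

FiniteRing≠0 : Ring c ℓ → Set (c ⊔ ℓ)
FiniteRing≠0 R = Finite R × ¬ (Ring._≈_ R (Ring.1# R) (Ring.0# R))

ΠRaw : {t : ℕ} → (Fin t → Ring c ℓ) → RawRing c ℓ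
ΠRaw {t = t} R = record
  { Carrier = (i : Fin t) → Ring.Carrier (R i)
  ; _≈_     = λ x y → (i : Fin t) → Ring._≈_ (R i) (x i) (y i)
  ; _+_     = λ x y i → Ring._+_ (R i) (x i) (y i)
  ; _*_     = λ x y i → Ring._*_ (R i) (x i) (y i)
  ; -_      = λ x i → Ring.-_ (R i) (x i)
  ; 0#      = λ i → Ring.0# (R i)
  ; 1#      = λ i → Ring.1# (R i)
  }

module UnitGraph {c ℓ} (S : RawRing c ℓ) where
  open RawRing S

  Unit : Pred Carrier (c ⊔ ℓ)
  Unit x = Σ[ y ∈ Carrier ] (x * y ≈ 1#) × (y * x ≈ 1#)

  ｛_｝ : Carrier → Pred Carrier ℓ
  ｛ z ｝ = λ w → w ≈ z

  Independent : ∀ {q} → Pred Carrier q → Set (c ⊔ ℓ ⊔ q)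
  Independent M = ∀ {x y} → x ∈ M → y ∈ M → ¬ (x ≈ y) → ¬ Unit (x + y)

  MaximalIndependent : Pred Carrier p → Set (c ⊔ ℓ ⊔ p)
  MaximalIndependent M = Independent M × (∀ z → Independent (M ∪ ｛ z ｝) → z ∈ M)

module UG {c ℓ} (R : Ring c ℓ) = UnitGraph (Ring.rawRing R)

{-# OPTIONS --safe #-}
-- x + y is a unit of R exactly when every coordinate x j + y j is a unit of R j.
-- (1) Members x, y of the cylinder over Mᵢ are never adjacent: if xᵢ ≉ yᵢ by independence
-- of Mᵢ, and if xᵢ ≈ yᵢ because xᵢ + xᵢ a unit makes xᵢ a unit.  If a ∈ Mᵢ were adjacent
-- to zᵢ, the vector with i-th coordinate a and 1 - z j elsewhere would be a member
-- adjacent to z; so zᵢ ∈ Mᵢ by maximality of Mᵢ.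
-- (2) Each w ∈ R j has some m ∈ M j with m + w a unit: a neighbour if w ∉ M j, and w
-- itself if w ∈ M j, as 2 and w are units.  Putting a neighbour a ∈ Mᵢ of zᵢ in place of
-- the i-th such m again gives a member adjacent to z.
-- Constructively, "some coordinate differs" and "w ∈ M j or not" are only available under
-- double negation, which commutes with the finite product over Fin t.
module Submission where

open import Defs
open import Level using (Level)
open import Data.Nat using (ℕ; _≤_; zero; suc)
open import Data.Fin using (Fin; zero; suc)
open import Data.Fin.Properties using (_≟_)
open import Data.Product using (_×_; _,_; proj₁; proj₂; Σ-syntax)
open import Data.Sum using (inj₁; inj₂)
open import Relation.Nullary using (¬_; yes; no; contradiction)
open import Relation.Unary using (Pred; _∈_; _∉_; _∪_)
open import Relation.Binary.Definitions using (_Respects_)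
open import Relation.Binary.PropositionalEquality as ≡ using (_≡_; refl)
open import Algebra.Bundles using (Ring)
open import Algebra.Bundles.Raw using (RawRing)
import Algebra.Properties.Group as GroupProperties
import Relation.Binary.Reasoning.Setoid as SetoidReasoning

¬¬-Π : ∀ {q} {t : ℕ} {Q : Fin t → Set q} → (∀ j → ¬ ¬ Q j) → ¬ ¬ (∀ j → Q j)
¬¬-Π {t = zero}      _ k = k λ ()
¬¬-Π {t = suc t} {Q} h k =
  h zero λ q₀ → ¬¬-Π {Q = λ j → Q (suc j)} (λ j → h (suc j)) λ qₛ →
    k λ { zero → q₀ ; (suc j) → qₛ j }

module _ {a} {t : ℕ} {A : Fin t → Set a} where

  update : (i : Fin t) → A i → ((j : Fin t) → A j) → (j : Fin t) → A j
  update i x f j with i ≟ j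
  ... | yes refl = x
  ... | no  _    = f j

  update-same : ∀ i x f → update i x f i ≡ x
  update-same i x f with i ≟ i
  ... | yes refl = refl
  ... | no  i≢i  = contradiction refl i≢i

  update-preserves : ∀ {q} (Q : (j : Fin t) → A j → Set q) {i x f} →
                     Q i x → (∀ j → Q j (f j)) → ∀ j → Q j (update i x f j)
  update-preserves Q {i} qx qf j with i ≟ j
  ... | yes refl = qx
  ... | no  _    = qf j

module UnitGraphProperties {c ℓ} (R : Ring c ℓ) where
  open Ring R
  open UG R
  open SetoidReasoning setoid

  Unit-resp : Unit Respects _≈_
  Unit-resp x≈y (u , xu≈1 , ux≈1) =
    u , trans (*-congʳ (sym x≈y)) xu≈1 , trans (*-congˡ (sym x≈y)) ux≈1

  Unit-* : ∀ {x y} → Unit x → Unit y → Unit (x * y)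
  Unit-* {x} {y} (u , xu≈1 , ux≈1) (v , yv≈1 , vy≈1) = v * u , right , left
    where
    right : x * y * (v * u) ≈ 1#
    right = begin
      x * y * (v * u)    ≈⟨ *-assoc x y (v * u) ⟩
      x * (y * (v * u))  ≈⟨ *-congˡ (*-assoc y v u) ⟨
      x * (y * v * u)    ≈⟨ *-congˡ (trans (*-congʳ yv≈1) (*-identityˡ u)) ⟩
      x * u              ≈⟨ xu≈1 ⟩
      1#                 ∎
    left : v * u * (x * y) ≈ 1#
    left = begin
      v * u * (x * y)    ≈⟨ *-assoc v u (x * y) ⟩
      v * (u * (x * y))  ≈⟨ *-congˡ (*-assoc u x y) ⟨
      v * (u * x * y)    ≈⟨ *-congˡ (trans (*-congʳ ux≈1) (*-identityˡ y)) ⟩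
      v * y              ≈⟨ vy≈1 ⟩
      1#                 ∎

  Unit-1-x+x : ∀ x → Unit ((1# - x) + x)
  Unit-1-x+x x = Unit-resp (sym (GroupProperties.//-rightDividesˡ +-group x 1#))
                           (1# , *-identityˡ 1# , *-identityˡ 1#)

  Unit-x+x : Unit (1# + 1#) → ∀ {x} → Unit x → Unit (x + x)
  Unit-x+x two {x} ux = Unit-resp 2x≈x+x (Unit-* two ux)
    where
    2x≈x+x : (1# + 1#) * x ≈ x + x
    2x≈x+x = trans (distribʳ x 1# 1#) (+-cong (*-identityˡ x) (*-identityˡ x))

  Unit-x+x⇒Unit-x : ∀ {x} → Unit (x + x) → Unit x
  Unit-x+x⇒Unit-x {x} (u , p , q) = u + u , right , left
    where
    right : x * (u + u) ≈ 1#
    right = trans (distribˡ x u u) (trans (sym (distribʳ u x x)) p)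
    left : (u + u) * x ≈ 1#
    left = trans (distribʳ x u u) (trans (sym (distribˡ u x x)) q)

  module _ {p} {M : Pred Carrier p} where

    Independent-∪-｛｝ : ∀ {z} → Independent M →
                         (∀ {a} → a ∈ M → a ≉ z → ¬ Unit (a + z)) →
                         Independent (M ∪ ｛ z ｝)
    Independent-∪-｛｝ ind _ (inj₁ a∈M) (inj₁ b∈M) a≉b = ind a∈M b∈M a≉b
    Independent-∪-｛｝ _ nonadj {a} {b} (inj₁ a∈M) (inj₂ b≈z) a≉b U =
      nonadj a∈M (λ a≈z → a≉b (trans a≈z (sym b≈z))) (Unit-resp (+-congˡ b≈z) U)
    Independent-∪-｛｝ _ nonadj {a} {b} (inj₂ a≈z) (inj₁ b∈M) a≉b U =
      nonadj b∈M (λ b≈z → a≉b (trans a≈z (sym b≈z)))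
                 (Unit-resp (trans (+-comm a b) (+-congˡ a≈z)) U)
    Independent-∪-｛｝ _ _ (inj₂ a≈z) (inj₂ b≈z) a≉b _ = a≉b (trans a≈z (sym b≈z))

    nonadjacent⇒∈ : MaximalIndependent M → ∀ {z} →
                    (∀ {a} → a ∈ M → a ≉ z → ¬ Unit (a + z)) → z ∈ M
    nonadjacent⇒∈ (ind , maximal) nonadj = maximal _ (Independent-∪-｛｝ ind nonadj)

    Independent-nonunits⇒¬Unit-+ : Independent M → (∀ x → x ∈ M → ¬ Unit x) →
                                   ∀ {x y} → x ∈ M → y ∈ M → ¬ Unit (x + y)
    Independent-nonunits⇒¬Unit-+ ind nonunit {x} x∈M y∈M U =
      (λ x≉y → ind x∈M y∈M x≉y U)
      (λ x≈y → nonunit x x∈M (Unit-x+x⇒Unit-x (Unit-resp (+-congˡ (sym x≈y)) U)))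

    ¬¬-member-with-Unit-+ : Unit (1# + 1#) → (∀ x → x ∈ M → Unit x) → MaximalIndependent M →
                            ∀ z → ¬ ¬ (Σ[ m ∈ Carrier ] m ∈ M × Unit (m + z))
    ¬¬-member-with-Unit-+ two unit maxM z none = none (z , z∈M , Unit-x+x two (unit z z∈M))
      where
      z∈M : z ∈ M
      z∈M = nonadjacent⇒∈ maxM λ a∈M _ U → none (_ , a∈M , U)

module ProductUnitGraph {c ℓ} {t : ℕ} (R : Fin t → Ring c ℓ) where
  open UnitGraph (ΠRaw R)
  open RawRing (ΠRaw R) using (Carrier; _≈_)
  module R (j : Fin t) where
    open Ring (R j) public
    open UG (R j) public
    open UnitGraphProperties (R j) public

  Unit-tabulate : ∀ {w} → (∀ j → R.Unit j (w j)) → Unit w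
  Unit-tabulate u = (λ j → proj₁ (u j)) , (λ j → proj₁ (proj₂ (u j))) , (λ j → proj₂ (proj₂ (u j)))

  Unit-lookup : ∀ {w} → Unit w → ∀ j → R.Unit j (w j)
  Unit-lookup (u , wu≈1 , uw≈1) j = u j , wu≈1 j , uw≈1 j

  update-∉ : ∀ {q} {P : Pred Carrier q} {z} → Independent (P ∪ ｛ z ｝) →
             ∀ {i a} → ¬ R._≈_ i a (z i) → R.Unit i (R._+_ i a (z i)) →
             ∀ g → (∀ j → R.Unit j (R._+_ j (g j) (z j))) → update i a g ∉ P
  update-∉ {z = z} ind {i} {a} a≉zᵢ a+zᵢ g g+z x∈P =
    ind (inj₁ x∈P) (inj₂ λ j → R.refl j) x≉z
        (Unit-tabulate (update-preserves (λ j v → R.Unit j (R._+_ j v (z j))) a+zᵢ g+z))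
    where
    x≉z : ¬ update i a g ≈ z
    x≉z x≈z = a≉zᵢ (≡.subst (λ v → R._≈_ i v (z i)) (update-same i a g) (x≈z i))

  module _ {p} (M : (j : Fin t) → Pred (R.Carrier j) p) where

    cylinder-maximalIndependent : ∀ i → R.MaximalIndependent i (M i) →
                                  (∀ x → x ∈ M i → ¬ R.Unit i x) →
                                  MaximalIndependent (λ x → x i ∈ M i)
    cylinder-maximalIndependent i maxMᵢ@(indMᵢ , _) nonunit = ind , maximal
      where
      ind : Independent (λ x → x i ∈ M i)
      ind x∈ y∈ _ U = R.Independent-nonunits⇒¬Unit-+ i indMᵢ nonunit x∈ y∈ (Unit-lookup U i)
      maximal : ∀ z → Independent ((λ x → x i ∈ M i) ∪ ｛ z ｝) → z i ∈ M i
      maximal z indz = R.nonadjacent⇒∈ i maxMᵢ λ {a} a∈Mᵢ a≉zᵢ a+zᵢ →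
        let g = λ j → R._-_ j (R.1# j) (z j) in
        update-∉ indz a≉zᵢ a+zᵢ g (λ j → R.Unit-1-x+x j (z j))
                 (≡.subst (M i) (≡.sym (update-same i a g)) a∈Mᵢ)

    product-independent : (∀ j → R.Independent j (M j)) → Independent (λ x → ∀ j → x j ∈ M j)
    product-independent ind x∈ y∈ x≉y U =
      ¬¬-Π (λ j xⱼ≉yⱼ → ind j (x∈ j) (y∈ j) xⱼ≉yⱼ (Unit-lookup U j)) x≉y

    product-maximalIndependent : (∀ j → R.Unit j (R._+_ j (R.1# j) (R.1# j))) →
                                 (∀ j x → x ∈ M j → R.Unit j x) →
                                 (∀ j → R.MaximalIndependent j (M j)) →
                                 MaximalIndependent (λ x → ∀ j → x j ∈ M j)
    product-maximalIndependent two unit maxM =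
      product-independent (λ j → proj₁ (maxM j)) , maximal
      where
      maximal : ∀ z → Independent ((λ x → ∀ j → x j ∈ M j) ∪ ｛ z ｝) → ∀ i → z i ∈ M i
      maximal z indz i = R.nonadjacent⇒∈ i (maxM i) λ {a} a∈Mᵢ a≉zᵢ a+zᵢ →
        ¬¬-Π (λ j → R.¬¬-member-with-Unit-+ j (two j) (unit j) (maxM j) (z j)) λ m →
          let g = λ j → proj₁ (m j) in
          update-∉ indz a≉zᵢ a+zᵢ g (λ j → proj₂ (proj₂ (m j)))
                   (update-preserves (λ j v → v ∈ M j) a∈Mᵢ (λ j → proj₁ (proj₂ (m j))))

lemma2p5 : ∀ {c ℓ p : Level} (t : ℕ) → 1 ≤ t →
           (R : Fin t → Ring c ℓ) → (∀ i → FiniteRing≠0 (R i)) →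
           (M : (i : Fin t) → Pred (Ring.Carrier (R i)) p) →
           (∀ i → M i Respects Ring._≈_ (R i)) →
           (∀ i → UG.MaximalIndependent (R i) (M i)) →
           ((i : Fin t) →
              (∀ x → x ∈ M i → ¬ UG.Unit (R i) x) →
              UnitGraph.MaximalIndependent (ΠRaw R) (λ x → x i ∈ M i))
           ×
           (UnitGraph.Unit (ΠRaw R) (RawRing._+_ (ΠRaw R) (RawRing.1# (ΠRaw R)) (RawRing.1# (ΠRaw R))) →
              (∀ i → ∀ x → x ∈ M i → UG.Unit (R i) x) →
              UnitGraph.MaximalIndependent (ΠRaw R) (λ x → ∀ i → x i ∈ M i))
lemma2p5 _ _ R _ M _ maxM =
    (λ i → cylinder-maximalIndependent M i (maxM i))
  , (λ two unit → product-maximalIndependent M (Unit-lookup two) unit maxM)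
  where open ProductUnitGraph R
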